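{- Let $\mathtt{Compress}_{\mathtt{SR}}:\Sigma^*\to(\Sigma')^*$ be the LZ77 compression function with self-referencing and unbounded sliding window size $W=n$, as described in the context. Then, for strings of length $n$, $$\mathrm{GS}_{\mathtt{Compress}_{\mathtt{SR}}}\le\Big(\tfrac{\sqrt[3]{9}}{2}n^{2/3}+\tfrac{\sqrt[3]{3}}{2}n^{1/3}+3\Big)\big(2\lceil\log n\rceil+\lceil\log|\Sigma|\rceil\big)=O(n^{2/3}\log n).$$
   Context: All logarithms are base 2. For $w\in\Sigma^n$, $w[i]$ is its $i$-th character and $w[a,b]$ the substring from position $a$ to $b$. LZ77 with self-referencing and window $W\le n$: the output on $w\in\Sigma^n$ is a sequence of blocks $B_1,\dots,B_t$, $B_i=[q_i,\ell_i,c_i]$ with integers $0\le q_i,\ell_i<n$ and $c_i\in\Sigma$. Greedily, $B_1=[0,0,w[1]]$; if the first $\mathsf{ctc}<n$ characters have been encoded, the next block uses the largest $\ell\ge 0$ (with $\mathsf{ctc}+\ell<n$) such that $w[\mathsf{ctc}+1,\mathsf{ctc}+\ell]=w[q,q+\ell-1]$ for some start position $q$ with $\max\{1,\mathsf{ctc}-W+1\}\le q\le\mathsf{ctc}$ (the copied source may overlap the part being encoded, i.e. $q+\ell-1>\mathsf{ctc}$ is allowed); if $\ell=0$ the block is $[0,0,w[\mathsf{ctc}+1]]$, otherwise it is $[q,\ell,w[\mathsf{ctc}+\ell+1]]$; then $\mathsf{ctc}$ increases by $\ell+1$, and the algorithm stops when $\mathsf{ctc}=n$. Each block is encoded with $2\lceil\log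 n\rceil+\lceil\log|\Sigma|\rceil$ bits, so the output length is $t(2\lceil\log n\rceil+\lceil\log|\Sigma|\rceil)$. Strings $w,w'\in\Sigma^n$ are neighbors ($w\sim w'$) if they differ in exactly one position, and the global sensitivity is $\max_{w\in\Sigma^n}\max_{w'\sim w}\big||\mathtt{Compress}_{\mathtt{SR}}(w)|-|\mathtt{Compress}_{\mathtt{SR}}(w')|\big|$. -}

module Defs where

open import Data.Nat using (ℕ; zero; suc; _+_; _*_; _∸_; _≤_; _<_; ∣_-_∣)
open import Data.Nat.Logarithm using (⌈log₂_⌉)
open import Data.Fin using (Fin) renaming (_≟_ to _≟F_)
open import Data.List using (List; []; _∷_; drop; map; upTo; length)
open import Data.Vec using (Vec; toList; lookup)
open import Data.Product using (_×_; _,_; ∃)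
open import Relation.Nullary using (yes; no; ¬_)
open import Relation.Binary.PropositionalEquality using (_≡_; _≢_)

Block : ℕ → Set
Block σ = ℕ × ℕ × Fin σ

lcp : ∀ {σ} → List (Fin σ) → List (Fin σ) → ℕ
lcp [] _ = 0
lcp (x ∷ xs) [] = 0
lcp (x ∷ xs) (y ∷ ys) with x ≟F y
... | yes _ = suc (lcp xs ys)
... | no _ = 0

_⊓_ : ℕ → ℕ → ℕ
zero ⊓ _ = zero
suc m ⊓ zero = zero
suc m ⊓ suc n = suc (m ⊓ n)

-- Returns (1-indexed start q , ℓ); starts from (0 , 0).
best : ∀ {σ} → List (Fin σ) → List (Fin σ) → ℕ → List ℕ → ℕ × ℕ → ℕ × ℕ
best w target cap [] acc = acc
best w target cap (q′ ∷ qs) (q , ℓ) with ℓ Data.Nat.<? (lcp (drop q′ w) target ⊓ cap)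
... | yes _ = best w target cap qs (suc q′ , lcp (drop q′ w) target ⊓ cap)
... | no _ = best w target cap qs (q , ℓ)

-- greedy LZ77 with self-referencing and window W, on the whole string w.
-- `ctc` = number of characters already encoded (0-indexed next position).
-- Candidate 1-indexed starts q ∈ [max{1, ctc-W+1}, ctc], i.e. 0-indexed
-- q′ ∈ [ctc ∸ W , ctc - 1].  The source w[q..] is read from w itself, so
-- overlapping (self-referencing) copies are allowed.
lzGo : ∀ {σ} → ℕ → List (Fin σ) → ℕ → ℕ → List (Block σ)
lzGo W w zero ctc = []
lzGo W w (suc fuel) ctc with drop ctc w
... | [] = []
... | target@(_ ∷ _) with best w target (length target ∸ 1)
                               (map (λ i → (ctc ∸ W) + i) (upTo (ctc ∸ (ctc ∸ W)))) (0 , 0)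
...   | (q , ℓ) with drop ℓ target
...     | [] = []
...     | c ∷ _ with ℓ
...       | zero = (0 , 0 , c) ∷ lzGo W w fuel (ctc + 1)
...       | suc ℓ′ = (q , suc ℓ′ , c) ∷ lzGo W w fuel (ctc + suc ℓ′ + 1)

-- output blocks of LZ77 (self-referencing, window W) on w ∈ Σⁿ.
-- n steps of fuel suffice since every block encodes ≥ 1 character.
lz77 : ∀ {σ n} → ℕ → Vec (Fin σ) n → List (Block σ)
lz77 {n = n} W w = lzGo W (toList w) n 0

blockBits : ℕ → ℕ → ℕ
blockBits n σ = 2 * ⌈log₂ n ⌉ + ⌈log₂ σ ⌉

compressLen : ∀ {σ n} → Vec (Fin σ) n → ℕ
compressLen {σ} {n} w = length (lz77 n w) * blockBits n σ

Neighbors : ∀ {σ n} → Vec (Fin σ) n → Vec (Fin σ) n → Set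
Neighbors {n = n} w w′ =
  ∃ λ (i : Fin n) → (lookup w i ≢ lookup w′ i) × (∀ j → j ≢ i → lookup w j ≡ lookup w′ j)

-- BelowBound D n c  encodes the real inequality
--     D ≤ ( ∛9/2 · n^{2/3} + ∛3/2 · n^{1/3} + 3 ) · c .
-- With x = (3n)^{1/3} the right side is (x(x+1)/2 + 3)·c.  Since y ↦ y(y+1)/2 is
-- continuous and strictly increasing on y ≥ 0, the inequality holds iff for every
-- nonnegative rational y = p/q:  y(y+1)/2 · c < D - 3c  implies  y³ < 3n.
-- Cleared of denominators (truncated subtraction is harmless: if D ≤ 3c the
-- premise is false and the inequality holds trivially):
BelowBound : ℕ → ℕ → ℕ → Set
BelowBound D n c = ∀ (p q : ℕ) → 1 ≤ q →
  p * (p + q) * c < 2 * (D ∸ 3 * c) * (q * q) →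
  p * p * p < 3 * n * (q * q * q)

{-# OPTIONS --safe #-}
-- With an unbounded window the end a + ℓ(a) of the greedy phrase starting at a is monotone
-- in a (the tail of a phrase is a candidate copy), so the greedy parse of a string uses no
-- more blocks than any other parse into copy phrases.  Let w′ differ from w at position i.
-- Walking along the greedy parse of w gives a parse of w′: phrases avoiding i survive, the
-- phrase through i is cut at i, and a later phrase whose source covers i is either
-- redirected to a copy of that source starting in (i, a) or cut in two.  A cut of a phrase
-- of length L at offset o of its source is charged to the key (L, o); keys are distinct,
-- since a repeated key would have been redirected to its first occurrence, and their
-- lengths sum to at most n.  Hence |t − t′| ≤ K + 1 for K distinct keys (L, o), o < L,
-- with ΣL ≤ n.  At most 1 + 2 + … + j keys have L ≤ j, so (m+1)K ≤ n + m(m+1)(m+2)/6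
-- for every m, and m = ⌊y⌋ gives K ≤ y(y+1)/2 + 2 as soon as y³ ≥ 3n.
module Submission where

open import Defs
open import Data.Nat
  using (ℕ; zero; suc; pred; _+_; _*_; _∸_; _≤_; _<_; z≤n; s≤s; z<s; ∣_-_∣; _≤?_; _<?_; _≟_; >-nonZero)
import Data.Nat as ℕ
open import Data.Nat.Properties
open import Data.Nat.DivMod using (_/_; _%_; m≡m%n+[m/n]*n; m%n<n)
open import Data.Fin using (Fin; zero; suc; toℕ; fromℕ<) renaming (_≟_ to _≟F_)
open import Data.Fin.Properties using (toℕ<n; toℕ-fromℕ<)
open import Data.Vec using (Vec; []; _∷_; toList; lookup)
open import Data.Vec.Properties using (length-toList)
open import Data.List using (List; []; _∷_; drop; map; upTo; length; filter)
open import Data.List.Properties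
  using (length-map; length-drop; drop-drop; drop-all; filter-all; filter-accept; filter-reject)
open import Data.Nat.ListAction using (sum)
open import Algebra.Properties.CommutativeSemigroup +-commutativeSemigroup using (interchange)
open import Relation.Binary.Definitions using (tri<; tri≈; tri>)
open import Relation.Unary using (Decidable)
open import Data.List.Membership.Propositional using (_∈_)
open import Data.List.Membership.Propositional.Properties using (∈-map⁺; ∈-map⁻; ∈-upTo⁺; ∈-upTo⁻)
open import Data.List.Relation.Unary.Any using (here; there)
open import Data.List.Relation.Unary.All using (All; []; _∷_)
import Data.List.Relation.Unary.All as All
import Data.List.Relation.Unary.All.Properties as All
import Data.List.Relation.Unary.Unique.Propositional.Properties as Unique
open import Data.List.Relation.Unary.Unique.Propositional using (Unique)
open import Data.List.Relation.Unary.AllPairs using ([]; _∷_)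
open import Data.Product using (_×_; _,_; ∃; proj₁; proj₂)
open import Data.Sum using (_⊎_; inj₁; inj₂)
open import Data.Maybe using (Maybe; just; nothing)
open import Data.Maybe.Properties using (just-injective)
open import Data.Empty using (⊥-elim)
open import Relation.Nullary using (yes; no; ¬_; ¬?; Dec)
open import Relation.Nullary.Decidable using (map′; _×-dec_)
open import Relation.Binary.PropositionalEquality
open import Function using (_∘_)
open import Data.Nat.Tactic.RingSolver using (solve-∀)

at : ∀ {A : Set} → List A → ℕ → Maybe A
at []       _       = nothing
at (x ∷ xs) zero    = just x
at (x ∷ xs) (suc k) = at xs k

at-drop : ∀ {A : Set} d (xs : List A) k → at (drop d xs) k ≡ at xs (d + k)
at-drop zero    xs       k = refl
at-drop (suc d) []       k = refl
at-drop (suc d) (x ∷ xs) k = at-drop d xs k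

m<o∸n⇒n+m<o : ∀ {m} n o → m < o ∸ n → n + m < o
m<o∸n⇒n+m<o zero    o       m<o   = m<o
m<o∸n⇒n+m<o (suc n) (suc o) m<o∸n = s≤s (m<o∸n⇒n+m<o n o m<o∸n)

Agree : ∀ {A : Set} → List A → List A → ℕ → Set
Agree {A} xs ys L = ∀ k → k < L → ∃ λ (x : A) → at xs k ≡ just x × at ys k ≡ just x

module _ {A : Set} where

  Agree-≤ : ∀ {xs ys : List A} {L L′} → L′ ≤ L → Agree xs ys L → Agree xs ys L′
  Agree-≤ L′≤L agr k k<L′ = agr k (<-≤-trans k<L′ L′≤L)

  Agree-drop : ∀ {xs ys : List A} {L} d → Agree xs ys L → Agree (drop d xs) (drop d ys) (L ∸ d)
  Agree-drop {xs} {ys} {L} d agr k k<L∸d with agr (d + k) (m<o∸n⇒n+m<o d L k<L∸d)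
  ... | x , xs[d+k] , ys[d+k] = x , trans (at-drop d xs k) xs[d+k] , trans (at-drop d ys k) ys[d+k]

  Agree-redirect : ∀ {xs ys zs : List A} {L} → Agree xs ys L → Agree xs zs L → Agree ys zs L
  Agree-redirect xy xz k k<L with xy k k<L | xz k k<L
  ... | x , xs[k] , ys[k] | _ , xs[k]′ , zs[k] =
    x , ys[k] , trans zs[k] (cong just (just-injective (trans (sym xs[k]′) xs[k])))

module _ {σ : ℕ} where

  ≤lcp⇒Agree : ∀ (xs ys : List (Fin σ)) {L} → L ≤ lcp xs ys → Agree xs ys L
  ≤lcp⇒Agree xs       ys       {zero}  _   k ()
  ≤lcp⇒Agree []       ys       {suc L} ()
  ≤lcp⇒Agree (x ∷ xs) []       {suc L} ()
  ≤lcp⇒Agree (x ∷ xs) (y ∷ ys) {suc L} L≤lcp k k<L with x ≟F y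
  ≤lcp⇒Agree (x ∷ xs) (y ∷ ys) {suc L} _           zero    _         | yes refl = x , refl , refl
  ≤lcp⇒Agree (x ∷ xs) (y ∷ ys) {suc L} (s≤s L≤lcp) (suc k) (s≤s k<L) | yes refl = ≤lcp⇒Agree xs ys L≤lcp k k<L
  ≤lcp⇒Agree (x ∷ xs) (y ∷ ys) {suc L} ()          _       _         | no _

  Agree⇒≤lcp : ∀ (xs ys : List (Fin σ)) L → Agree xs ys L → L ≤ lcp xs ys
  Agree⇒≤lcp xs       ys       zero    agr = z≤n
  Agree⇒≤lcp []       ys       (suc L) agr with () ← proj₁ (proj₂ (agr 0 (s≤s z≤n)))
  Agree⇒≤lcp (x ∷ xs) []       (suc L) agr with () ← proj₂ (proj₂ (agr 0 (s≤s z≤n)))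
  Agree⇒≤lcp (x ∷ xs) (y ∷ ys) (suc L) agr with x ≟F y | agr 0 (s≤s z≤n)
  ... | yes refl | _ = s≤s (Agree⇒≤lcp xs ys L (λ k k<L → agr (suc k) (s≤s k<L)))
  ... | no x≢y | _ , refl , refl = ⊥-elim (x≢y refl)

Matches : ∀ {A : Set} → List A → ℕ → ℕ → ℕ → Set
Matches s q a L = Agree (drop q s) (drop a s) L

Matches-shift : ∀ {A : Set} (s : List A) q a {L} d → Matches s q a L → Matches s (q + d) (a + d) (L ∸ d)
Matches-shift s q a d m
  rewrite sym (drop-drop q d s) | sym (drop-drop a d s) = Agree-drop d m

Matches-suffix : ∀ {A : Set} (s : List A) q a {L} o → Matches s q a L → Matches s (q + o + 1) (a + o + 1) (L ∸ (o + 1))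
Matches-suffix s q a {L} o m =
  subst₂ (λ q′ a′ → Matches s q′ a′ (L ∸ (o + 1))) (sym (+-assoc q o 1)) (sym (+-assoc a o 1))
    (Matches-shift s q a (o + 1) m)

Matches? : ∀ {σ} (s : List (Fin σ)) q a L → Dec (Matches s q a L)
Matches? s q a L =
  map′ (≤lcp⇒Agree (drop q s) (drop a s)) (Agree⇒≤lcp (drop q s) (drop a s) L) (L ≤? lcp (drop q s) (drop a s))

⊓≡ℕ⊓ : ∀ m n → m ⊓ n ≡ m ℕ.⊓ n
⊓≡ℕ⊓ zero    n       = refl
⊓≡ℕ⊓ (suc m) zero    = refl
⊓≡ℕ⊓ (suc m) (suc n) = cong suc (⊓≡ℕ⊓ m n)

module _ {σ : ℕ} (s target : List (Fin σ)) (cap : ℕ) where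

  candidateLength : ℕ → ℕ
  candidateLength q = lcp (drop q s) target ⊓ cap

  best-preserves : (P : ℕ → Set) → ∀ qs q ℓ → P ℓ → (∀ {q′} → q′ ∈ qs → P (candidateLength q′)) →
                   P (proj₂ (best s target cap qs (q , ℓ)))
  best-preserves P []        q ℓ Pℓ Pqs = Pℓ
  best-preserves P (q′ ∷ qs) q ℓ Pℓ Pqs with ℓ <? candidateLength q′
  ... | yes _ = best-preserves P qs (suc q′) (candidateLength q′) (Pqs (here refl)) (Pqs ∘ there)
  ... | no _  = best-preserves P qs q ℓ Pℓ (Pqs ∘ there)

  best-≥-initial : ∀ qs q ℓ → ℓ ≤ proj₂ (best s target cap qs (q , ℓ))
  best-≥-initial []        q ℓ = ≤-refl
  best-≥-initial (q′ ∷ qs) q ℓ with ℓ <? candidateLength q′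
  ... | yes ℓ< = ≤-trans (<⇒≤ ℓ<) (best-≥-initial qs (suc q′) (candidateLength q′))
  ... | no _   = best-≥-initial qs q ℓ

  best-≥-candidate : ∀ qs q ℓ {q′} → q′ ∈ qs → candidateLength q′ ≤ proj₂ (best s target cap qs (q , ℓ))
  best-≥-candidate (q′ ∷ qs) q ℓ (here refl) with ℓ <? candidateLength q′
  ... | yes _ = best-≥-initial qs (suc q′) (candidateLength q′)
  ... | no ℓ≮ = ≤-trans (≮⇒≥ ℓ≮) (best-≥-initial qs q ℓ)
  best-≥-candidate (q₀ ∷ qs) q ℓ (there q′∈) with ℓ <? candidateLength q₀
  ... | yes _ = best-≥-candidate qs (suc q₀) (candidateLength q₀) q′∈
  ... | no _  = best-≥-candidate qs q ℓ q′∈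

window : ℕ → ℕ → List ℕ
window W a = map (λ i → (a ∸ W) + i) (upTo (a ∸ (a ∸ W)))

greedyLength : ∀ {σ} → ℕ → List (Fin σ) → ℕ → ℕ
greedyLength W s a = proj₂ (best s (drop a s) (length (drop a s) ∸ 1) (window W a) (0 , 0))

greedyLength-≤ : ∀ {σ} W (s : List (Fin σ)) a → greedyLength W s a ≤ length (drop a s) ∸ 1
greedyLength-≤ W s a = best-preserves s (drop a s) cap (_≤ cap) (window W a) 0 0 z≤n
  (λ {q} _ → subst (_≤ cap) (sym (⊓≡ℕ⊓ (lcp (drop q s) (drop a s)) cap)) (m⊓n≤n _ cap))
  where cap = length (drop a s) ∸ 1

0<length-drop : ∀ {A : Set} ℓ (ys : List A) → ℓ < length ys → 0 < length (drop ℓ ys)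
0<length-drop ℓ ys ℓ< = subst (0 <_) (sym (length-drop ℓ ys)) (m<n⇒0<n∸m ℓ<)

length-lzGo-step : ∀ {σ} W (s : List (Fin σ)) f a → a < length s →
  length (lzGo W s (suc f) a) ≡ suc (length (lzGo W s f (a + greedyLength W s a + 1)))
length-lzGo-step W s f a a<len
  with drop a s | greedyLength-≤ W s a | 0<length-drop a s a<len
... | x ∷ xs | ℓ≤ | _ with best s (x ∷ xs) (length xs) (window W a) (0 , 0)
... | q , ℓ with drop ℓ (x ∷ xs) | 0<length-drop ℓ (x ∷ xs) (s≤s ℓ≤)
... | c ∷ _ | _ with ℓ
... | zero   = cong (λ b → suc (length (lzGo W s f (b + 1)))) (sym (+-identityʳ a))
... | suc _  = refl

m<m+n+1 : ∀ m n → m < m + n + 1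
m<m+n+1 m n = ≤-<-trans (m≤m+n m n) (m<m+n (m + n) z<s)

+-suc-comm : ∀ m n → n + suc m ≡ suc (m + n)
+-suc-comm m n = trans (+-suc n m) (cong suc (+-comm n m))

m+n<o⇒n≤o∸suc[m] : ∀ m {n o} → m + n < o → n ≤ o ∸ suc m
m+n<o⇒n≤o∸suc[m] m {n} {o} m+n<o = m+n≤o⇒m≤o∸n n (subst (_≤ o) (sym (+-suc-comm m n)) m+n<o)

n≤o∸suc[m]⇒m+n<o : ∀ m {n o} → m < o → n ≤ o ∸ suc m → m + n < o
n≤o∸suc[m]⇒m+n<o m {n} {o} m<o n≤ = subst (_≤ o) (+-suc-comm m n) (m≤o∸n⇒m+n≤o n m<o n≤)

module Greedy {σ : ℕ} (n : ℕ) (s : List (Fin σ)) (length-s : length s ≡ n) where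

  blocksWithFuel : ℕ → ℕ → ℕ
  blocksWithFuel f a = length (lzGo n s f a)

  blocks : ℕ → ℕ
  blocks = blocksWithFuel n

  ℓ : ℕ → ℕ
  ℓ = greedyLength n s

  next : ℕ → ℕ
  next a = a + ℓ a + 1

  Copyable : ℕ → ℕ → Set
  Copyable a L = L ≡ 0 ⊎ ∃ λ q → q < a × Matches s q a L

  -- A block covering positions a, …, a + L: L copied characters and one explicit one.
  Phrase : ℕ → ℕ → Set
  Phrase a L = a + L < n × Copyable a L

  cap : ℕ → ℕ
  cap a = length (drop a s) ∸ 1

  cap≡ : ∀ a → cap a ≡ n ∸ suc a
  cap≡ a = begin
    length (drop a s) ∸ 1 ≡⟨ cong (_∸ 1) (trans (length-drop a s) (cong (_∸ a) length-s)) ⟩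
    n ∸ a ∸ 1             ≡⟨ ∸-+-assoc n a 1 ⟩
    n ∸ (a + 1)           ≡⟨ cong (n ∸_) (+-comm a 1) ⟩
    n ∸ suc a             ∎
    where open ≡-Reasoning

  window-∈⁻ : ∀ {a q} → a ≤ n → q ∈ window n a → q < a
  window-∈⁻ a≤n q∈ rewrite m≤n⇒m∸n≡0 a≤n with ∈-map⁻ (0 +_) q∈
  ... | i , i∈ , refl = ∈-upTo⁻ i∈

  window-∈⁺ : ∀ {a q} → a ≤ n → q < a → q ∈ window n a
  window-∈⁺ a≤n q<a rewrite m≤n⇒m∸n≡0 a≤n = ∈-map⁺ (0 +_) (∈-upTo⁺ q<a)

  greedy-phrase : ∀ {a} → a < n → Phrase a (ℓ a)
  greedy-phrase {a} a<n = inside , copy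
    where
    inside : a + ℓ a < n
    inside = n≤o∸suc[m]⇒m+n<o a a<n (subst (ℓ a ≤_) (cap≡ a) (greedyLength-≤ n s a))
    copy : Copyable a (ℓ a)
    copy = best-preserves s (drop a s) (cap a) (Copyable a)
      (window n a) 0 0 (inj₁ refl)
      (λ {q} q∈ → inj₂ (q , window-∈⁻ (<⇒≤ a<n) q∈ , ≤lcp⇒Agree (drop q s) (drop a s)
        (subst (_≤ lcp (drop q s) (drop a s)) (sym (⊓≡ℕ⊓ _ (cap a))) (m⊓n≤m _ (cap a)))))

  greedy-longest : ∀ {q a L} → q < a → a + L < n → Matches s q a L → L ≤ ℓ a
  greedy-longest {q} {a} {L} q<a a+L<n m = ≤-trans L≤candidate
    (best-≥-candidate s (drop a s) (cap a) (window n a) 0 0 (window-∈⁺ (≤-trans (m≤m+n a L) (<⇒≤ a+L<n)) q<a))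
    where
    L≤candidate : L ≤ candidateLength s (drop a s) (cap a) q
    L≤candidate = subst (L ≤_) (sym (⊓≡ℕ⊓ _ (cap a)))
      (⊓-glb (Agree⇒≤lcp (drop q s) (drop a s) L m) (subst (L ≤_) (sym (cap≡ a)) (m+n<o⇒n≤o∸suc[m] a a+L<n)))

  -- The tail of the greedy phrase at a, read from b onwards, is a candidate copy at b.
  end-mono : ∀ {a b} → a ≤ b → b < n → a + ℓ a ≤ b + ℓ b
  end-mono {a} {b} a≤b b<n with greedy-phrase (≤-<-trans a≤b b<n)
  ... | _ , inj₁ ℓa≡0 = begin
    a + ℓ a ≡⟨ cong (a +_) ℓa≡0 ⟩
    a + 0   ≡⟨ +-identityʳ a ⟩
    a       ≤⟨ a≤b ⟩
    b       ≤⟨ m≤m+n b (ℓ b) ⟩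
    b + ℓ b ∎
    where open ≤-Reasoning
  ... | inside , inj₂ (q , q<a , m) with a + ℓ a ≤? b
  ...   | yes end≤b = ≤-trans end≤b (m≤m+n b (ℓ b))
  ...   | no end≰b = begin
    a + ℓ a           ≡⟨ end≡ ⟩
    b + (ℓ a ∸ d)     ≤⟨ +-monoʳ-≤ b (greedy-longest q+d<b (subst (_< n) end≡ inside) tail) ⟩
    b + ℓ b           ∎
    where
    open ≤-Reasoning
    d = b ∸ a
    a+d≡b : a + d ≡ b
    a+d≡b = m+[n∸m]≡n a≤b
    d≤ℓa : d ≤ ℓ a
    d≤ℓa = m≤n+o⇒m∸n≤o b a (<⇒≤ (≰⇒> end≰b))
    end≡ : a + ℓ a ≡ b + (ℓ a ∸ d)
    end≡ = trans (cong (a +_) (sym (m+[n∸m]≡n d≤ℓa))) (trans (sym (+-assoc a d _)) (cong (_+ (ℓ a ∸ d)) a+d≡b))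
    q+d<b : q + d < b
    q+d<b = subst (q + d <_) a+d≡b (+-monoˡ-< d q<a)
    tail : Matches s (q + d) b (ℓ a ∸ d)
    tail = subst (λ b → Matches s (q + d) b (ℓ a ∸ d)) a+d≡b (Matches-shift s q a d m)

  next≤n : ∀ {a} → a < n → next a ≤ n
  next≤n {a} a<n = subst (_≤ n) (+-comm 1 (a + ℓ a)) (proj₁ (greedy-phrase a<n))

  a<next : ∀ a → a < next a
  a<next a = m<m+n+1 a (ℓ a)

  fuel-decreases : ∀ {a b g} → a < b → n ∸ a ≤ suc g → n ∸ b ≤ g
  fuel-decreases {a} {b} {g} a<b fuel =
    ≤-trans (∸-monoʳ-≤ n a<b) (subst (_≤ g) (pred[m∸n]≡m∸[1+n] n a) (pred-mono-≤ fuel))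

  blocksWithFuel-end : ∀ f {a} → n ≤ a → blocksWithFuel f a ≡ 0
  blocksWithFuel-end zero    n≤a = refl
  blocksWithFuel-end (suc f) {a} n≤a with drop a s | drop-all a s (subst (_≤ a) (sym length-s) n≤a)
  ... | .[] | refl = refl

  blocksWithFuel-step : ∀ f {a} → a < n → blocksWithFuel (suc f) a ≡ suc (blocksWithFuel f (next a))
  blocksWithFuel-step f {a} a<n = length-lzGo-step n s f a (subst (a <_) (sym length-s) a<n)

  blocksWithFuel-antitone : ∀ f f′ {a a′} → a ≤ a′ → n ∸ a ≤ f → n ∸ a′ ≤ f′ →
                            blocksWithFuel f′ a′ ≤ blocksWithFuel f a
  blocksWithFuel-antitone f f′ {a} {a′} a≤a′ fuel fuel′ with n ≤? a′
  ... | yes n≤a′ = subst (_≤ blocksWithFuel f a) (sym (blocksWithFuel-end f′ n≤a′)) z≤n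
  ... | no n≰a′ with ≰⇒> n≰a′ | f | f′
  ...   | a′<n | zero  | _      = ⊥-elim (<⇒≱ (m<n⇒0<n∸m (≤-<-trans a≤a′ a′<n)) fuel)
  ...   | a′<n | suc g | zero   = ⊥-elim (<⇒≱ (m<n⇒0<n∸m a′<n) fuel′)
  ...   | a′<n | suc g | suc g′
    rewrite blocksWithFuel-step g (≤-<-trans a≤a′ a′<n) | blocksWithFuel-step g′ a′<n =
    s≤s (blocksWithFuel-antitone g g′ (+-monoˡ-≤ 1 (end-mono a≤a′ a′<n))
          (fuel-decreases (a<next a) fuel) (fuel-decreases (a<next a′) fuel′))

  blocks-antitone : ∀ {a a′} → a ≤ a′ → blocks a′ ≤ blocks a
  blocks-antitone {a} {a′} a≤a′ = blocksWithFuel-antitone n n a≤a′ (m∸n≤m n a) (m∸n≤m n a′)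

  blocks-end : ∀ {a} → n ≤ a → blocks a ≡ 0
  blocks-end = blocksWithFuel-end n

  blocksWithFuel-irrelevant : ∀ {f a} → n ∸ a ≤ f → blocksWithFuel f a ≡ blocks a
  blocksWithFuel-irrelevant {f} {a} fuel = ≤-antisym
    (blocksWithFuel-antitone n f ≤-refl (m∸n≤m n a) fuel)
    (blocksWithFuel-antitone f n ≤-refl fuel (m∸n≤m n a))

  blocks-step : ∀ {a} → a < n → blocks a ≡ suc (blocks (next a))
  blocks-step {a} a<n = begin
    blocks a                              ≡⟨ cong (λ f → blocksWithFuel f a) (sym n≡suc[pred[n]]) ⟩
    blocksWithFuel (suc (pred n)) a       ≡⟨ blocksWithFuel-step (pred n) a<n ⟩
    suc (blocksWithFuel (pred n) (next a)) ≡⟨ cong suc (blocksWithFuel-irrelevant fuel) ⟩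
    suc (blocks (next a))                 ∎
    where
    open ≡-Reasoning
    n≡suc[pred[n]] : suc (pred n) ≡ n
    n≡suc[pred[n]] = suc-pred n {{>-nonZero (≤-<-trans z≤n a<n)}}
    fuel : n ∸ next a ≤ pred n
    fuel = fuel-decreases (≤-<-trans z≤n (a<next a)) (≤-reflexive (sym n≡suc[pred[n]]))

  blocks-phrase : ∀ {a L} → Phrase a L → blocks a ≤ suc (blocks (a + L + 1))
  blocks-phrase {a} {L} (a+L<n , copy) rewrite blocks-step (≤-<-trans (m≤m+n a L) a+L<n) =
    s≤s (blocks-antitone (+-monoˡ-≤ 1 (+-monoʳ-≤ a (L≤ℓ copy))))
    where
    L≤ℓ : Copyable a L → L ≤ ℓ a
    L≤ℓ (inj₁ refl)          = z≤n
    L≤ℓ (inj₂ (q , q<a , m)) = greedy-longest q<a a+L<n m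

split-end : ∀ a {o L} → o < L → a + o + 1 + (L ∸ (o + 1)) ≡ a + L
split-end a {o} {L} o<L = begin
  a + o + 1 + (L ∸ (o + 1))   ≡⟨ cong (_+ (L ∸ (o + 1))) (+-assoc a o 1) ⟩
  a + (o + 1) + (L ∸ (o + 1)) ≡⟨ +-assoc a (o + 1) _ ⟩
  a + (o + 1 + (L ∸ (o + 1))) ≡⟨ cong (a +_) (m+[n∸m]≡n (subst (_≤ L) (+-comm 1 o) o<L)) ⟩
  a + L                       ∎
  where open ≡-Reasoning

Key : Set
Key = ℕ × ℕ

Proper : Key → Set
Proper (L , o) = o < L

weight : List Key → ℕ
weight S = sum (map proj₁ S)

ProperKeys : ℕ → List Key → Set
ProperKeys n S = Unique S × All Proper S × weight S ≤ n

module Neighbours {σ : ℕ} (n : ℕ) (s s′ : List (Fin σ)) (length-s : length s ≡ n) (length-s′ : length s′ ≡ n)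
                  (i : ℕ) (i<n : i < n) (agree : ∀ k → k ≢ i → at s k ≡ at s′ k) where

  module G  = Greedy n s  length-s
  module G′ = Greedy n s′ length-s′

  Avoids : ℕ → ℕ → Set
  Avoids q L = i < q ⊎ q + L ≤ i

  avoids-or-covers : ∀ q L → Avoids q L ⊎ (q ≤ i × i < q + L)
  avoids-or-covers q L with i <? q | q + L ≤? i
  ... | yes i<q | _         = inj₁ (inj₁ i<q)
  ... | no _    | yes q+L≤i = inj₁ (inj₂ q+L≤i)
  ... | no i≮q  | no q+L≰i  = inj₂ (≮⇒≥ i≮q , ≰⇒> q+L≰i)

  avoids-≢ : ∀ {q L k} → Avoids q L → k < L → q + k ≢ i
  avoids-≢ {q} {k = k} (inj₁ i<q)   k<L q+k≡i = <⇒≱ i<q (subst (q ≤_) q+k≡i (m≤m+n q k))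
  avoids-≢ {q} {L}     (inj₂ q+L≤i) k<L q+k≡i = <⇒≱ (+-monoʳ-< q k<L) (subst (q + L ≤_) (sym q+k≡i) q+L≤i)

  agree-drop : ∀ {q L} → Avoids q L → ∀ {k} → k < L → at (drop q s) k ≡ at (drop q s′) k
  agree-drop {q} av {k} k<L = begin
    at (drop q s) k  ≡⟨ at-drop q s k ⟩
    at s (q + k)     ≡⟨ agree (q + k) (avoids-≢ av k<L) ⟩
    at s′ (q + k)    ≡⟨ at-drop q s′ k ⟨
    at (drop q s′) k ∎
    where open ≡-Reasoning

  Matches-transfer : ∀ {q a L} → Avoids q L → Avoids a L → Matches s q a L → Matches s′ q a L
  Matches-transfer avq ava m k k<L with m k k<L
  ... | x , s[q+k] , s[a+k] = x , trans (sym (agree-drop avq k<L)) s[q+k] , trans (sym (agree-drop ava k<L)) s[a+k]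

  -- The source of the phrase cut at i starts at i ∸ o.
  FreshKey : ℕ → Key → Set
  FreshKey a (L , o) = o < L × o ≤ i × (∀ r → i < r → r < a → ¬ Matches s (i ∸ o) r L)

  Admissible : ℕ → List Key → Set
  Admissible a S = Unique S × All (FreshKey a) S × weight S + a ≤ n

  Admissible-anti : ∀ {a a′ S} → a′ ≤ a → Admissible a S → Admissible a′ S
  Admissible-anti {S = S} a′≤a (unique , fresh , fits) =
    unique ,
    All.map (λ (o<L , o≤i , no-copy) → o<L , o≤i , λ r i<r r<a′ → no-copy r i<r (<-≤-trans r<a′ a′≤a)) fresh ,
    ≤-trans (+-monoʳ-≤ (weight S) a′≤a) fits

  Admissible⇒ProperKeys : ∀ {a S} → Admissible a S → ProperKeys n S
  Admissible⇒ProperKeys {S = S} (unique , fresh , fits) = unique , All.map proj₁ fresh , m+n≤o⇒m≤o (weight S) fits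

  -- Quantified over the bound X so that length Sb need not be subtracted.
  Reparse : ℕ → ℕ → List Key → Set
  Reparse a b Sb = ∃ λ Sa → Admissible a Sa ×
    (∀ X → G′.blocks b ≤ X + length Sb → G′.blocks a ≤ suc (X + length Sa))

  reparse-same : ∀ {a L Sb} → G′.Phrase a L → Admissible (a + L + 1) Sb → Reparse a (a + L + 1) Sb
  reparse-same {a} {L} {Sb} phrase adm =
    Sb , Admissible-anti (<⇒≤ (m<m+n+1 a L)) adm ,
    λ X bound → ≤-trans (G′.blocks-phrase phrase) (s≤s bound)

  reparse-cut : ∀ {a L q Sb} → i < a → a + L < n → q < a → Matches s q a L → q ≤ i → i < q + L →
    (∀ r → r < a → ¬ (i < r × Matches s q r L)) → Admissible (a + L + 1) Sb → Reparse a (a + L + 1) Sb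
  reparse-cut {a} {L} {q} {Sb} i<a a+L<n q<a m q≤i i<q+L no-copy (unique , fresh , fits) =
    (L , o) ∷ Sb , (distinct ∷ unique , key-fresh ∷ proj₁ (proj₂ adm) , fits′) , cost
    where
    adm = Admissible-anti (<⇒≤ (m<m+n+1 a L)) (unique , fresh , fits)
    o = i ∸ q
    q+o≡i : q + o ≡ i
    q+o≡i = m+[n∸m]≡n q≤i
    o<L : o < L
    o<L = +-cancelˡ-< q o L (subst (_< q + L) (sym q+o≡i) i<q+L)
    i∸o≡q : i ∸ o ≡ q
    i∸o≡q = m∸[m∸n]≡n q≤i
    key-fresh : FreshKey a (L , o)
    key-fresh = o<L , m∸n≤m i q ,
      λ r i<r r<a m′ → no-copy r r<a (i<r , subst (λ q′ → Matches s q′ r L) i∸o≡q m′)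
    distinct : All ((L , o) ≢_) Sb
    distinct = All.map (λ { (_ , _ , no-copy′) refl →
      no-copy′ a i<a (m<m+n+1 a L) (subst (λ q′ → Matches s q′ a L) (sym i∸o≡q) m) }) fresh
    fits′ : L + weight Sb + a ≤ n
    fits′ = ≤-trans (≤-trans (m≤m+n _ 1) (≤-reflexive (regroup L (weight Sb) a))) fits
      where
      regroup : ∀ L W a → L + W + a + 1 ≡ W + (a + L + 1)
      regroup = solve-∀
    first : G′.Phrase a o
    first = ≤-<-trans (+-monoʳ-≤ a (<⇒≤ o<L)) a+L<n ,
      inj₂ (q , q<a , Matches-transfer (inj₂ (≤-reflexive q+o≡i)) (inj₁ i<a)
        (Agree-≤ {xs = drop q s} {drop a s} (<⇒≤ o<L) m))
    i<i+1 : i < i + 1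
    i<i+1 = m<m+n i z<s
    i+1<a+o+1 : i + 1 < a + o + 1
    i+1<a+o+1 = +-monoˡ-< 1 (<-≤-trans i<a (m≤m+n a o))
    second : G′.Phrase (a + o + 1) (L ∸ (o + 1))
    second = subst (_< n) (sym (split-end a o<L)) a+L<n ,
      inj₂ (i + 1 , i+1<a+o+1 , Matches-transfer (inj₁ i<i+1) (inj₁ (<-trans i<i+1 i+1<a+o+1))
        (subst (λ q′ → Matches s (q′ + 1) (a + o + 1) (L ∸ (o + 1))) q+o≡i (Matches-suffix s q a o m)))
    cost : ∀ X → G′.blocks (a + L + 1) ≤ X + length Sb → G′.blocks a ≤ suc (X + suc (length Sb))
    cost X bound = begin
      G′.blocks a                                          ≤⟨ G′.blocks-phrase first ⟩
      suc (G′.blocks (a + o + 1))                          ≤⟨ s≤s (G′.blocks-phrase second) ⟩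
      suc (suc (G′.blocks (a + o + 1 + (L ∸ (o + 1)) + 1)))
        ≡⟨ cong (λ e → suc (suc (G′.blocks (e + 1)))) (split-end a o<L) ⟩
      suc (suc (G′.blocks (a + L + 1)))                    ≤⟨ s≤s (s≤s bound) ⟩
      suc (suc (X + length Sb))                            ≡⟨ cong suc (+-suc X (length Sb)) ⟨
      suc (X + suc (length Sb))                            ∎
      where open ≤-Reasoning

  reparse : ∀ {a L Sb} → i < a → G.Phrase a L → Admissible (a + L + 1) Sb → Reparse a (a + L + 1) Sb
  reparse i<a (a+L<n , inj₁ refl) = reparse-same (a+L<n , inj₁ refl)
  reparse {a} {L} i<a (a+L<n , inj₂ (q , q<a , m)) with avoids-or-covers q L
  ... | inj₁ avoids = reparse-same (a+L<n , inj₂ (q , q<a , Matches-transfer avoids (inj₁ i<a) m))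
  ... | inj₂ (q≤i , i<q+L) with anyUpTo? (λ r → (i <? r) ×-dec Matches? s q r L) a
  ...   | yes (r , r<a , i<r , copy) = reparse-same (a+L<n , inj₂ (r , r<a ,
          Matches-transfer (inj₁ i<r) (inj₁ i<a) (Agree-redirect {xs = drop q s} {drop r s} {drop a s} copy m)))
  ...   | no no-copy = reparse-cut i<a a+L<n q<a m q≤i i<q+L (λ r r<a copy → no-copy (r , r<a , copy))

  blocks-after : ∀ f {a} → n ∸ a ≤ f → i < a → a ≤ n →
                 ∃ λ S → Admissible a S × G′.blocks a ≤ G.blocks a + length S
  blocks-after f {a} fuel i<a a≤n with n ≤? a | f
  ... | yes n≤a | _     = [] , ([] , [] , a≤n) , subst (_≤ G.blocks a + 0) (sym (G′.blocks-end n≤a)) z≤n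
  ... | no n≰a  | zero  = ⊥-elim (<⇒≱ (m<n⇒0<n∸m (≰⇒> n≰a)) fuel)
  ... | no n≰a  | suc g
    with blocks-after g (G.fuel-decreases (G.a<next a) fuel) (<-trans i<a (G.a<next a)) (G.next≤n (≰⇒> n≰a))
  ...   | Sb , adm , bound with reparse i<a (G.greedy-phrase (≰⇒> n≰a)) adm
  ...     | Sa , adm′ , cost = Sa , adm′ ,
            subst (λ b → G′.blocks a ≤ b + length Sa) (sym (G.blocks-step (≰⇒> n≰a))) (cost _ bound)

  blocks-resume : ∀ {a} → a ≤ i → i < G.next a → ∀ {Sb} → Admissible (G.next a) Sb →
           G′.blocks (G.next a) ≤ G.blocks (G.next a) + length Sb →
           ∃ λ S → ProperKeys n S × G′.blocks (a + (i ∸ a) + 1) ≤ suc (G.blocks (G.next a) + length S)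
  blocks-resume {a} a≤i i<next {Sb} adm bound with m≤n⇒m<n∨m≡n o≤ℓ | proj₂ (G.greedy-phrase a<n)
    where
    a<n = ≤-<-trans a≤i i<n
    o = i ∸ a
    o≤ℓ : o ≤ G.ℓ a
    o≤ℓ = m≤n+o⇒m∸n≤o i a (m<1+n⇒m≤n (subst (i <_) (+-comm (a + G.ℓ a) 1) i<next))
  ... | inj₂ o≡ℓ | _ = Sb , Admissible⇒ProperKeys adm ,
        ≤-trans (≤-reflexive (cong (λ o → G′.blocks (a + o + 1)) o≡ℓ)) (≤-trans bound (n≤1+n _))
  ... | inj₁ o<ℓ | inj₁ ℓ≡0 = ⊥-elim (<⇒≱ o<ℓ (≤-trans (≤-reflexive ℓ≡0) z≤n))
  ... | inj₁ o<ℓ | inj₂ (q , q<a , m)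
    with reparse i<a+o+1 remainder (subst (λ e → Admissible (e + 1) Sb) (sym (split-end a o<ℓ)) adm)
    where
    o = i ∸ a
    i<a+o+1 : i < a + o + 1
    i<a+o+1 = subst (λ e → i < e + 1) (sym (m+[n∸m]≡n a≤i)) (m<m+n i z<s)
    remainder : G.Phrase (a + o + 1) (G.ℓ a ∸ (o + 1))
    remainder = subst (_< n) (sym (split-end a o<ℓ)) (proj₁ (G.greedy-phrase (≤-<-trans a≤i i<n))) ,
      inj₂ (q + o + 1 , +-monoˡ-< 1 (+-monoˡ-< o q<a) , Matches-suffix s q a o m)
  ...   | Sa , adm′ , cost = Sa , Admissible⇒ProperKeys adm′ ,
          cost _ (subst (λ e → G′.blocks (e + 1) ≤ G.blocks (G.next a) + length Sb) (sym (split-end a o<ℓ)) bound)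

  blocks-through : ∀ {a} → a ≤ i → i < G.next a → ∀ {Sb} → Admissible (G.next a) Sb →
            G′.blocks (G.next a) ≤ G.blocks (G.next a) + length Sb →
            ∃ λ S → ProperKeys n S × G′.blocks a ≤ suc (G.blocks a + length S)
  blocks-through {a} a≤i i<next adm bound with blocks-resume a≤i i<next adm bound
  ... | S , keys , resumed = S , keys , (begin
    G′.blocks a                                ≤⟨ G′.blocks-phrase first ⟩
    suc (G′.blocks (a + o + 1))                ≤⟨ s≤s resumed ⟩
    suc (suc (G.blocks (G.next a) + length S)) ≡⟨ cong (λ b → suc (b + length S)) (G.blocks-step a<n) ⟨
    suc (G.blocks a + length S)                ∎)
    where
    open ≤-Reasoning
    a<n = ≤-<-trans a≤i i<n
    ℓ = G.ℓ a
    o = i ∸ a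
    a+o≡i : a + o ≡ i
    a+o≡i = m+[n∸m]≡n a≤i
    o≤ℓ : o ≤ ℓ
    o≤ℓ = m≤n+o⇒m∸n≤o i a (m<1+n⇒m≤n (subst (i <_) (+-comm (a + ℓ) 1) i<next))
    first : G′.Phrase a o
    first = subst (_< n) (sym a+o≡i) i<n , copy (proj₂ (G.greedy-phrase a<n))
      where
      copy : G.Copyable a ℓ → G′.Copyable a o
      copy (inj₁ ℓ≡0)           = inj₁ (n≤0⇒n≡0 (subst (o ≤_) ℓ≡0 o≤ℓ))
      copy (inj₂ (q , q<a , m)) = inj₂ (q , q<a , Matches-transfer
        (inj₂ (subst (q + o ≤_) a+o≡i (+-monoˡ-≤ o (<⇒≤ q<a)))) (inj₂ (≤-reflexive a+o≡i))
        (Agree-≤ {xs = drop q s} {drop a s} o≤ℓ m))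

  blocks-before : ∀ f {a} → n ∸ a ≤ f → a ≤ i →
                  ∃ λ S → ProperKeys n S × G′.blocks a ≤ suc (G.blocks a + length S)
  blocks-before zero    fuel a≤i = ⊥-elim (<⇒≱ (m<n⇒0<n∸m (≤-<-trans a≤i i<n)) fuel)
  blocks-before (suc f) {a} fuel a≤i with G.next a ≤? i
  ... | no next≰i with blocks-after f (G.fuel-decreases (G.a<next a) fuel) (≰⇒> next≰i) (G.next≤n a<n)
    where a<n = ≤-<-trans a≤i i<n
  ...   | Sb , adm , bound = blocks-through a≤i (≰⇒> next≰i) adm bound
  blocks-before (suc f) {a} fuel a≤i | yes next≤i with blocks-before f (G.fuel-decreases (G.a<next a) fuel) next≤i
  ...   | S , keys , bound = S , keys , (begin
    G′.blocks a                                ≤⟨ G′.blocks-phrase unchanged ⟩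
    suc (G′.blocks (G.next a))                 ≤⟨ s≤s bound ⟩
    suc (suc (G.blocks (G.next a) + length S)) ≡⟨ cong (λ b → suc (b + length S)) (G.blocks-step a<n) ⟨
    suc (G.blocks a + length S)                ∎)
    where
    open ≤-Reasoning
    a<n = ≤-<-trans a≤i i<n
    end≤i : a + G.ℓ a ≤ i
    end≤i = ≤-trans (m≤m+n (a + G.ℓ a) 1) next≤i
    unchanged : G′.Phrase a (G.ℓ a)
    unchanged with G.greedy-phrase a<n
    ... | inside , inj₁ ℓ≡0 = inside , inj₁ ℓ≡0
    ... | inside , inj₂ (q , q<a , m) = inside , inj₂ (q , q<a ,
          Matches-transfer (inj₂ (≤-trans (+-monoˡ-≤ (G.ℓ a) (<⇒≤ q<a)) end≤i)) (inj₂ end≤i) m)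

  blocks-neighbour : ∃ λ S → ProperKeys n S × G′.blocks 0 ≤ suc (G.blocks 0 + length S)
  blocks-neighbour = blocks-before n ≤-refl z≤n

triangular : ℕ → ℕ
triangular zero    = 0
triangular (suc j) = triangular j + suc j

tetrahedral : ℕ → ℕ
tetrahedral zero    = 0
tetrahedral (suc h) = tetrahedral h + triangular h

triangular-closed : ∀ j → 2 * triangular j ≡ j * (j + 1)
triangular-closed zero    = refl
triangular-closed (suc j) = begin
  2 * (triangular j + suc j)   ≡⟨ *-distribˡ-+ 2 (triangular j) (suc j) ⟩
  2 * triangular j + 2 * suc j ≡⟨ cong (_+ 2 * suc j) (triangular-closed j) ⟩
  j * (j + 1) + 2 * suc j      ≡⟨ step j ⟩
  suc j * (suc j + 1)          ∎
  where
  open ≡-Reasoning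
  step : ∀ j → j * (j + 1) + 2 * suc j ≡ suc j * (suc j + 1)
  step = solve-∀

tetrahedral-closed : ∀ m → 6 * tetrahedral (suc m) ≡ m * (m + 1) * (m + 2)
tetrahedral-closed zero    = refl
tetrahedral-closed (suc m) = begin
  6 * (tetrahedral (suc m) + triangular (suc m))          ≡⟨ *-distribˡ-+ 6 (tetrahedral (suc m)) _ ⟩
  6 * tetrahedral (suc m) + 3 * 2 * triangular (suc m)    ≡⟨ cong₂ _+_ (tetrahedral-closed m) (*-assoc 3 2 (triangular (suc m))) ⟩
  m * (m + 1) * (m + 2) + 3 * (2 * triangular (suc m))    ≡⟨ cong (λ t → m * (m + 1) * (m + 2) + 3 * t) (triangular-closed (suc m)) ⟩
  m * (m + 1) * (m + 2) + 3 * (suc m * (suc m + 1))       ≡⟨ step m ⟩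
  suc m * (suc m + 1) * (suc m + 2)                       ∎
  where
  open ≡-Reasoning
  step : ∀ m → m * (m + 1) * (m + 2) + 3 * (suc m * (suc m + 1)) ≡ suc m * (suc m + 1) * (suc m + 2)
  step = solve-∀

triangular-mono : ∀ {j k} → j ≤ k → triangular j ≤ triangular k
triangular-mono {zero}          _         = z≤n
triangular-mono {suc j} {suc k} (s≤s j≤k) = +-mono-≤ (triangular-mono j≤k) (s≤s j≤k)

module _ (N : ℕ) where

  ≢N? : Decidable (_≢ N)
  ≢N? x = ¬? (x ≟ N)

  length-filter-≢ : ∀ {xs} → Unique xs → length xs ≤ suc (length (filter ≢N? xs))
  length-filter-≢ {[]}     []              = z≤n
  length-filter-≢ {x ∷ xs} (x∉xs ∷ unique) with x ≟ N
  ... | yes refl = s≤s (≤-reflexive (cong length (begin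
    xs                   ≡⟨ filter-all ≢N? (All.map (_∘ sym) x∉xs) ⟨
    filter ≢N? xs        ≡⟨ filter-reject ≢N? (λ x≢x → x≢x refl) ⟨
    filter ≢N? (x ∷ xs)  ∎)))
    where open ≡-Reasoning
  ... | no x≢N   =
    ≤-trans (s≤s (length-filter-≢ unique)) (≤-reflexive (cong (suc ∘ length) (sym (filter-accept ≢N? x≢N))))

pigeonhole : ∀ N {xs} → Unique xs → All (_< N) xs → length xs ≤ N
pigeonhole zero    {[]}    _      _          = z≤n
pigeonhole zero    {_ ∷ _} _      (() ∷ _)
pigeonhole (suc N) {xs}    unique bounded    = ≤-trans (length-filter-≢ N unique) (s≤s (pigeonhole N
  (Unique.filter⁺ (≢N? N) unique)
  (All.zipWith (λ (x<1+N , x≢N) → ≤∧≢⇒< (m<1+n⇒m≤n x<1+N) x≢N)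
    (All.filter⁺ (≢N? N) bounded , All.all-filter (≢N? N) xs))))

encode : Key → ℕ
encode (zero  , o) = o
encode (suc L , o) = triangular L + o

encode-< : ∀ {h L o} → o < L → L ≤ h → encode (L , o) < triangular h
encode-< {L = suc L} {o} o<L L≤h = <-≤-trans (+-monoʳ-< (triangular L) o<L) (triangular-mono L≤h)

encode-injective : ∀ {k k′} → Proper k → Proper k′ → encode k ≡ encode k′ → k ≡ k′
encode-injective {suc L , o} {suc L′ , o′} o<L o′<L′ eq with <-cmp L L′
... | tri< L<L′ _ _ =
  ⊥-elim (<-irrefl eq (<-≤-trans (encode-< o<L ≤-refl) (≤-trans (triangular-mono L<L′) (m≤m+n _ o′))))
... | tri> _ _ L′<L =
  ⊥-elim (<-irrefl (sym eq) (<-≤-trans (encode-< o′<L′ ≤-refl) (≤-trans (triangular-mono L′<L) (m≤m+n _ o))))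
... | tri≈ _ refl _ = cong (suc L ,_) (+-cancelˡ-≡ (triangular L) o o′ eq)

Unique-map⁺ : ∀ {A B : Set} {P : A → Set} (f : A → B) → (∀ {x y} → P x → P y → f x ≡ f y → x ≡ y) →
              ∀ {xs} → All P xs → Unique xs → Unique (map f xs)
Unique-map⁺ f injective []           []              = []
Unique-map⁺ f injective (px ∷ pxs) (x∉xs ∷ unique) =
  All.map⁺ (All.zipWith (λ (py , x≢y) fx≡fy → x≢y (injective px py fx≡fy)) (pxs , x∉xs)) ∷
  Unique-map⁺ f injective pxs unique

Short : ℕ → Key → Set
Short h (L , _) = L ≤ h

Short? : ∀ h → Decidable (Short h)
Short? h (L , _) = L ≤? h

short-keys : ∀ h {S} → Unique S → All Proper S → All (Short h) S → length S ≤ triangular h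
short-keys h {S} unique proper short = subst (_≤ triangular h) (length-map encode S)
  (pigeonhole (triangular h) (Unique-map⁺ encode encode-injective proper unique)
    (All.map⁺ (All.zipWith (λ {(L , o)} (o<L , L≤h) → encode-< o<L L≤h) (proper , short))))

deficit : ℕ → List Key → ℕ
deficit h S = sum (map (λ k → h ∸ proj₁ k) S)

*-length≤weight+deficit : ∀ h S → h * length S ≤ weight S + deficit h S
*-length≤weight+deficit h [] = ≤-reflexive (*-zeroʳ h)
*-length≤weight+deficit h ((L , o) ∷ S) = begin
  h * suc (length S)                          ≡⟨ *-suc h (length S) ⟩
  h + h * length S                            ≤⟨ +-mono-≤ (m≤n+m∸n h L) (*-length≤weight+deficit h S) ⟩
  (L + (h ∸ L)) + (weight S + deficit h S)    ≡⟨ interchange L (h ∸ L) (weight S) (deficit h S) ⟩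
  (L + weight S) + ((h ∸ L) + deficit h S)    ∎
  where open ≤-Reasoning

deficit-suc : ∀ h S → deficit (suc h) S ≤ deficit h S + length (filter (Short? h) S)
deficit-suc h [] = z≤n
deficit-suc h ((L , o) ∷ S) with L ≤? h
... | yes L≤h = begin
  suc h ∸ L + deficit (suc h) S                ≡⟨ cong (_+ deficit (suc h) S) (+-∸-assoc 1 L≤h) ⟩
  suc (h ∸ L) + deficit (suc h) S              ≤⟨ s≤s (+-monoʳ-≤ (h ∸ L) (deficit-suc h S)) ⟩
  suc (h ∸ L + (deficit h S + length short))   ≡⟨ cong suc (+-assoc (h ∸ L) _ _) ⟨
  suc (h ∸ L + deficit h S + length short)     ≡⟨ +-suc _ (length short) ⟨
  h ∸ L + deficit h S + suc (length short)     ≡⟨ cong (λ ks → h ∸ L + deficit h S + length ks) (filter-accept (Short? h) L≤h) ⟨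
  h ∸ L + deficit h S + length (filter (Short? h) ((L , o) ∷ S)) ∎
  where
  open ≤-Reasoning
  short = filter (Short? h) S
... | no L≰h = begin
  suc h ∸ L + deficit (suc h) S                 ≡⟨ cong (_+ deficit (suc h) S) (m≤n⇒m∸n≡0 (≰⇒> L≰h)) ⟩
  deficit (suc h) S                             ≤⟨ deficit-suc h S ⟩
  deficit h S + length (filter (Short? h) S)    ≤⟨ +-monoˡ-≤ _ (m≤n+m (deficit h S) (h ∸ L)) ⟩
  h ∸ L + deficit h S + length (filter (Short? h) S) ≡⟨ cong (λ ks → h ∸ L + deficit h S + length ks) (filter-reject (Short? h) L≰h) ⟨
  h ∸ L + deficit h S + length (filter (Short? h) ((L , o) ∷ S)) ∎
  where open ≤-Reasoning

deficit≤tetrahedral : ∀ h {S} → Unique S → All Proper S → deficit h S ≤ tetrahedral h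
deficit≤tetrahedral zero    {S} _      _      = ≤-reflexive (deficit-zero S)
  where
  deficit-zero : ∀ S → deficit 0 S ≡ 0
  deficit-zero []      = refl
  deficit-zero ((L , _) ∷ S) = cong₂ _+_ (0∸n≡0 L) (deficit-zero S)
deficit≤tetrahedral (suc h) {S} unique proper = begin
  deficit (suc h) S                                     ≤⟨ deficit-suc h S ⟩
  deficit h S + length (filter (Short? h) S)  ≤⟨ +-mono-≤ (deficit≤tetrahedral h unique proper)
    (short-keys h (Unique.filter⁺ (Short? h) unique) (All.filter⁺ (Short? h) proper) (All.all-filter (Short? h) S)) ⟩
  tetrahedral h + triangular h                          ∎
  where open ≤-Reasoning

keys-count : ∀ {n S} → ProperKeys n S → ∀ h → h * length S ≤ n + tetrahedral h
keys-count {n} {S} (unique , proper , light) h = begin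
  h * length S              ≤⟨ *-length≤weight+deficit h S ⟩
  weight S + deficit h S    ≤⟨ +-mono-≤ light (deficit≤tetrahedral h unique proper) ⟩
  n + tetrahedral h         ∎
  where open ≤-Reasoning

-- With y = (m q + e) / q and e ≤ q this reads 2y³ + m(m+1)(m+2) ≤ 3(m+1)·y(y+1) + 12(m+1):
-- expand, and bound the terms of degree ≥ 2 in e by replacing one factor e by q.
cubic-≤ : ∀ m q e → e ≤ q →
  2 * ((m * q + e) * (m * q + e) * (m * q + e)) + m * (m + 1) * (m + 2) * (q * q * q)
    ≤ 3 * suc m * q * ((m * q + e) * (m * q + e + q)) + 12 * suc m * (q * q * q)
cubic-≤ m q e e≤q = begin
  2 * ((m * q + e) * (m * q + e) * (m * q + e)) + m * (m + 1) * (m + 2) * (q * q * q)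
    ≡⟨ expand-left m q e ⟩
  X + 6 * m * q * e * e + 2 * (e * e * e)
    ≤⟨ +-mono-≤ (+-monoʳ-≤ X (*-monoʳ-≤ (6 * m * q * e) e≤q)) (*-monoʳ-≤ 2 (*-mono-≤ (*-mono-≤ e≤q e≤q) e≤q)) ⟩
  X + 6 * m * q * e * q + 2 * (q * q * q)
    ≤⟨ m≤m+n _ _ ⟩
  X + 6 * m * q * e * q + 2 * (q * q * q) + B
    ≡⟨ expand-right m q e ⟩
  3 * suc m * q * ((m * q + e) * (m * q + e + q)) + 12 * suc m * (q * q * q) ∎
  where
  open ≤-Reasoning
  X = 3 * m * m * m * q * q * q + 3 * m * m * q * q * q + 2 * m * q * q * q + 6 * m * m * q * q * e
  B = (3 * m * m + 13 * m + 10) * (q * q * q) + (3 * m + 3) * (q * q * e) + (3 * m + 3) * (q * e * e)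
  expand-left : ∀ m q e →
    2 * ((m * q + e) * (m * q + e) * (m * q + e)) + m * (m + 1) * (m + 2) * (q * q * q)
      ≡ 3 * m * m * m * q * q * q + 3 * m * m * q * q * q + 2 * m * q * q * q + 6 * m * m * q * q * e
        + 6 * m * q * e * e + 2 * (e * e * e)
  expand-left = solve-∀
  expand-right : ∀ m q e →
    3 * m * m * m * q * q * q + 3 * m * m * q * q * q + 2 * m * q * q * q + 6 * m * m * q * q * e
      + 6 * m * q * e * q + 2 * (q * q * q)
      + ((3 * m * m + 13 * m + 10) * (q * q * q) + (3 * m + 3) * (q * q * e) + (3 * m + 3) * (q * e * e))
      ≡ 3 * suc m * q * ((m * q + e) * (m * q + e + q)) + 12 * suc m * (q * q * q)
  expand-right = solve-∀

-- The count at h = ⌊p / q⌋ + 1 against the cubic inequality.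
cube-bound : ∀ {n K} → (∀ h → h * K ≤ n + tetrahedral h) → BelowBound (suc K) n 1
cube-bound {K = zero}        _ p q _ ()
cube-bound {K = suc zero}    _ p q _ ()
cube-bound {n} {suc (suc d)} count p q@(suc _) _ premise =
  subst (λ x → x * x * x < 3 * n * q³) (sym p≡P) (*-cancelˡ-< 2 _ _ (subst (2 * (P * P * P) <_) six≡2·3
    (+-cancelʳ-< (Z * q³) _ _ chain)))
  where
  m = p / q
  e = p % q
  P = m * q + e
  q³ = q * q * q
  Z = m * (m + 1) * (m + 2)
  p≡P : p ≡ P
  p≡P = trans (m≡m%n+[m/n]*n p q) (+-comm e (m * q))
  premise′ : P * (P + q) < 2 * d * (q * q)
  premise′ = subst (λ x → x * (x + q) < 2 * d * (q * q)) p≡P (subst (_< 2 * d * (q * q)) (*-identityʳ _) premise)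
  six≡2·3 : 6 * n * q³ ≡ 2 * (3 * n * q³)
  six≡2·3 = trans (cong (_* q³) (*-assoc 2 3 n)) (*-assoc 2 (3 * n) q³)
  collect : ∀ m q d → 3 * suc m * q * (2 * d * (q * q)) + 12 * suc m * (q * q * q) ≡ 6 * (suc m * suc (suc d)) * (q * q * q)
  collect = solve-∀
  counted : 6 * (suc m * suc (suc d)) ≤ 6 * n + Z
  counted = begin
    6 * (suc m * suc (suc d))        ≤⟨ *-monoʳ-≤ 6 (count (suc m)) ⟩
    6 * (n + tetrahedral (suc m))    ≡⟨ *-distribˡ-+ 6 n _ ⟩
    6 * n + 6 * tetrahedral (suc m)  ≡⟨ cong (6 * n +_) (tetrahedral-closed m) ⟩
    6 * n + Z                        ∎
    where open ≤-Reasoning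
  chain : 2 * (P * P * P) + Z * q³ < 6 * n * q³ + Z * q³
  chain = begin-strict
    2 * (P * P * P) + Z * q³                              ≤⟨ cubic-≤ m q e (<⇒≤ (m%n<n p q)) ⟩
    3 * suc m * q * (P * (P + q)) + 12 * suc m * q³       <⟨ +-monoˡ-< (12 * suc m * q³) (*-monoʳ-< (3 * suc m * q) premise′) ⟩
    3 * suc m * q * (2 * d * (q * q)) + 12 * suc m * q³   ≡⟨ collect m q d ⟩
    6 * (suc m * suc (suc d)) * q³                        ≤⟨ *-monoˡ-≤ q³ counted ⟩
    (6 * n + Z) * q³                                      ≡⟨ *-distribʳ-+ q³ (6 * n) Z ⟩
    6 * n * q³ + Z * q³                                   ∎
    where open ≤-Reasoning

BelowBound-anti : ∀ {D D′ n c} → D ≤ D′ → BelowBound D′ n c → BelowBound D n c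
BelowBound-anti {c = c} D≤D′ bound p q 1≤q premise =
  bound p q 1≤q (<-≤-trans premise (*-monoˡ-≤ (q * q) (*-monoʳ-≤ 2 (∸-monoˡ-≤ (3 * c) D≤D′))))

BelowBound-scale : ∀ {D n} c → BelowBound D n 1 → BelowBound (D * c) n c
BelowBound-scale {D} c bound p q 1≤q premise =
  bound p q 1≤q (subst (_< 2 * (D ∸ 3) * (q * q)) (sym (*-identityʳ (p * (p + q)))) (*-cancelʳ-< c _ _ scaled))
  where
  regroup : ∀ a b c → 2 * (a * c) * b ≡ 2 * a * b * c
  regroup = solve-∀
  scaled : p * (p + q) * c < 2 * (D ∸ 3) * (q * q) * c
  scaled = subst (p * (p + q) * c <_)
    (trans (cong (λ x → 2 * x * (q * q)) (sym (*-distribʳ-∸ c D 3))) (regroup (D ∸ 3) (q * q) c)) premise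

at-toList : ∀ {A : Set} {n} (v : Vec A n) (j : Fin n) → at (toList v) (toℕ j) ≡ just (lookup v j)
at-toList (x ∷ v) zero    = refl
at-toList (x ∷ v) (suc j) = at-toList v j

at-toList-≥ : ∀ {A : Set} {n} (v : Vec A n) {k} → n ≤ k → at (toList v) k ≡ nothing
at-toList-≥ []      _           = refl
at-toList-≥ (x ∷ v) (s≤s n≤k) = at-toList-≥ v n≤k

at-toList-agree : ∀ {A : Set} {n} {w w′ : Vec A n} {i} → (∀ j → j ≢ i → lookup w j ≡ lookup w′ j) →
                  ∀ k → k ≢ toℕ i → at (toList w) k ≡ at (toList w′) k
at-toList-agree {n = n} {w} {w′} agree k k≢i with k <? n
... | no k≮n  = trans (at-toList-≥ w (≮⇒≥ k≮n)) (sym (at-toList-≥ w′ (≮⇒≥ k≮n)))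
... | yes k<n = begin
  at (toList w) k         ≡⟨ cong (at (toList w)) (toℕ-fromℕ< k<n) ⟨
  at (toList w) (toℕ j)   ≡⟨ at-toList w j ⟩
  just (lookup w j)       ≡⟨ cong just (agree j (λ j≡i → k≢i (trans (sym (toℕ-fromℕ< k<n)) (cong toℕ j≡i)))) ⟩
  just (lookup w′ j)      ≡⟨ at-toList w′ j ⟨
  at (toList w′) (toℕ j)  ≡⟨ cong (at (toList w′)) (toℕ-fromℕ< k<n) ⟩
  at (toList w′) k        ∎
  where
  open ≡-Reasoning
  j = fromℕ< k<n

lz77-neighbour : ∀ {σ n} (w w′ : Vec (Fin σ) n) (i : Fin n) → (∀ j → j ≢ i → lookup w j ≡ lookup w′ j) →
                 ∃ λ S → ProperKeys n S × length (lz77 n w′) ≤ suc (length (lz77 n w) + length S)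
lz77-neighbour {n = n} w w′ i agree = Neighbours.blocks-neighbour n (toList w) (toList w′)
  (length-toList w) (length-toList w′) (toℕ i) (toℕ<n i) (at-toList-agree {w = w} {w′} agree)

∸≤suc : ∀ {m n k} → n ≤ suc (m + k) → n ∸ m ≤ suc k
∸≤suc {m} {n} {k} n≤ = m≤n+o⇒m∸n≤o n m (subst (n ≤_) (sym (+-suc m k)) n≤)

lz77-distance : ∀ {σ n} (w w′ : Vec (Fin σ) n) → Neighbors w w′ →
                ∃ λ S → ProperKeys n S × ∣ length (lz77 n w) - length (lz77 n w′) ∣ ≤ suc (length S)
lz77-distance {n = n} w w′ (i , _ , agree)
  with lz77-neighbour w w′ i agree | lz77-neighbour w′ w i (λ j j≢i → sym (agree j j≢i))
     | ≤-total (length (lz77 n w)) (length (lz77 n w′))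
... | S , keys , w′≤ | _ | inj₁ t≤t′ =
  S , keys , subst (_≤ suc (length S)) (sym (m≤n⇒∣m-n∣≡n∸m t≤t′)) (∸≤suc w′≤)
... | _ | S , keys , w≤ | inj₂ t′≤t =
  S , keys , subst (_≤ suc (length S)) (sym (m≤n⇒∣n-m∣≡n∸m t′≤t)) (∸≤suc w≤)

theorem6 : ∀ (σ n : ℕ) → 1 ≤ σ → 1 ≤ n →
    (w w′ : Vec (Fin σ) n) → Neighbors w w′ →
    BelowBound ∣ compressLen w - compressLen w′ ∣ n (blockBits n σ)
theorem6 σ n _ _ w w′ neighbours with lz77-distance w w′ neighbours
... | S , keys , distance =
  subst (λ D → BelowBound D n c) (*-distribʳ-∣-∣ c t t′) (BelowBound-scale {∣ t - t′ ∣} {n} c unscaled)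
  where
  c = blockBits n σ
  t = length (lz77 n w)
  t′ = length (lz77 n w′)
  unscaled : BelowBound ∣ t - t′ ∣ n 1
  unscaled = BelowBound-anti {D′ = suc (length S)} {n} distance (cube-bound (keys-count keys))
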